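{- Let $a,b,x$ be non-commuting indeterminates. A Dyck word is a word $w$ in the letters $a,b$ (the empty word included) having as many $a$'s as $b$'s and such that every prefix of $w$ has at least as many $a$'s as $b$'s. Let $D$ be the formal power series in $a,b,x$ obtained by taking, for each Dyck word, the word obtained by replacing every occurrence of the factor $ab$ by the letter $x$, and summing these words over all Dyck words (so $D=1+x+x^2+axb+\cdots$). Let $U$ be the formal power series in $a,b,x$ defined by $$(1-aDb)^{ -1}=1+aUb.$$ Then $$U=(1+aUb)\big(1+(x-ab+ba)U\big),$$ and this equation completely defines $U$.
   Context: Equivalently, $D$ is the series satisfying $D=1+(x-ab+aDb)D$. All series live in the ring of formal power series in the non-commuting variables $a,b,x$ with integer coefficients. -}

module Defs where

open import Data.Bool using (Bool; true; false; _∧_; if_then_else_)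
open import Data.Nat as ℕ using (ℕ; zero; suc; _≡ᵇ_; _≤ᵇ_)
open import Data.Integer as ℤ using (ℤ; +_)
open import Data.List using (List; []; _∷_; _++_; map; length; inits; upTo; filterᵇ)
open import Data.Nat.ListAction using (sum)
open import Data.Product using (_×_; _,_; proj₁; proj₂)
open import Relation.Binary.PropositionalEquality using (_≡_)

data Letter : Set where
  a b x : Letter

Word : Set
Word = List Letter

-- Formal power series in non-commuting a,b,x with integer coefficients:
-- a coefficient for every word.
Series : Set
Series = Word → ℤ

infix 4 _≈_
_≈_ : Series → Series → Set
f ≈ g = ∀ (w : Word) → f w ≡ g w

_==L_ : Letter → Letter → Bool
a ==L a = true
b ==L b = true
x ==L x = true
_ ==L _ = false

_==W_ : Word → Word → Bool
[] ==W [] = true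
(c ∷ u) ==W (d ∷ v) = (c ==L d) ∧ (u ==W v)
_ ==W _ = false

mono : Word → Series
mono u w = if u ==W w then + 1 else + 0

𝟙 : Series
𝟙 = mono []

infixl 6 _⊕_ _⊖_
infixl 7 _⊛_

_⊕_ : Series → Series → Series
(f ⊕ g) w = f w ℤ.+ g w

_⊖_ : Series → Series → Series
(f ⊖ g) w = f w ℤ.- g w

splits : Word → List (Word × Word)
splits [] = ([] , []) ∷ []
splits (c ∷ w) = ([] , c ∷ w) ∷ map (λ p → (c ∷ proj₁ p , proj₂ p)) (splits w)

sumℤ : List ℤ → ℤ
sumℤ [] = + 0
sumℤ (z ∷ zs) = z ℤ.+ sumℤ zs

_⊛_ : Series → Series → Series
(f ⊛ g) w = sumℤ (map (λ p → f (proj₁ p) ℤ.* g (proj₂ p)) (splits w))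

A B X : Series
A = mono (a ∷ [])
B = mono (b ∷ [])
X = mono (x ∷ [])

sandwich : Series → Series
sandwich S = A ⊛ S ⊛ B

count : Letter → Word → ℕ
count c [] = 0
count c (d ∷ w) = if c ==L d then suc (count c w) else count c w

allB : {X : Set} → (X → Bool) → List X → Bool
allB p [] = true
allB p (y ∷ ys) = p y ∧ allB p ys

isAB : Letter → Bool
isAB a = true
isAB b = true
isAB x = false

isDyck : Word → Bool
isDyck w = allB isAB w ∧ (count a w ≡ᵇ count b w)
         ∧ allB (λ p → count b p ≤ᵇ count a p) (inits w)

replaceAB : Word → Word
replaceAB (a ∷ b ∷ w) = x ∷ replaceAB w
replaceAB (c ∷ w) = c ∷ replaceAB w
replaceAB [] = []

abWords : ℕ → List Word
abWords zero = [] ∷ []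
abWords (suc n) = map (a ∷_) (abWords n) ++ map (b ∷_) (abWords n)

-- D = Σ_{v Dyck} replaceAB v.  The coefficient of w counts the Dyck words v
-- with replaceAB v = w; such v satisfy |v| ≤ 2|w|, so the sum is finite and
-- ranges over a,b-words of length ≤ 2|w|.
D : Series
D w = + sum (map (λ n → length (filterᵇ (λ v → isDyck v ∧ (replaceAB v ==W w)) (abWords n)))
                 (upTo (suc (2 ℕ.* length w))))

module Submission where

open import Defs
open import Data.Bool using (Bool; true; false; _∧_; if_then_else_)
open import Data.Bool.Properties using (∧-zeroʳ)
open import Data.Nat as ℕ using (ℕ; zero; suc; _≤_; _<_; z≤n; s≤s; _≡ᵇ_; _≤ᵇ_; _+_; _*_)
import Data.Nat.Properties as NP
open import Data.Nat.ListAction using (sum)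
open import Data.Integer as ℤ using (ℤ; +_) renaming (_+_ to _+ᶻ_; _*_ to _*ᶻ_; _-_ to _-ᶻ_)
open import Data.Integer.Tactic.RingSolver using (solve-∀)
open import Data.List using (List; []; _∷_; _++_; map; length; inits; upTo; applyUpTo; filterᵇ)
import Data.List.Properties as LP
open import Data.Product using (Σ; _×_; _,_)
open import Function using (_∘_; id)
open import Relation.Binary.PropositionalEquality
  using (_≡_; refl; sym; trans; cong; cong₂; _→-setoid_; module ≡-Reasoning)
import Relation.Binary.Reasoning.Setoid as SetoidReasoning

-- Write E = aDb and Q = x - ab + ba.
--  * Series form a ring: the ring laws are proved coefficientwise by
--    induction on words, splitting a product by the first letter (⊛-cons).
--  * An operator on series that improves agreement on short words by one
--    letter is a contraction and has exactly one fixed point.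
--  * Counting Dyck paths by their ab-contraction, with D_k the series of paths
--    starting at height k, gives D = D_0, the first-passage law
--    D_m b D_k = D_{m+k+1}, and hence the equation (1 - (x - ab) - aDb) D = 1.
--  * 1 + aUb is a right inverse of 1 - E exactly when U = D(1 + baU); this
--    equation has a solution by contraction, and a right inverse of 1 - E is
--    two-sided since 1 - E also has a left inverse (again by contraction).
--  * If 1 + aUb inverts 1 - E, then U = D(1 + baU) and the equation of D yield
--    (1 - E) U = 1 + QU, so U = (1 + aUb)(1 - E) U = (1 + aUb)(1 + QU); this
--    equation is again a contraction, so it determines U.

∂ : Letter → Series → Series
∂ c f w = f (c ∷ w)

𝟘 : Series
𝟘 _ = + 0

⊛-cons : ∀ (f g : Series) c w → (f ⊛ g) (c ∷ w) ≡ f [] *ᶻ g (c ∷ w) +ᶻ (∂ c f ⊛ g) w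
⊛-cons f g c w = cong (f [] *ᶻ g (c ∷ w) +ᶻ_) (cong sumℤ (sym (LP.map-∘ (splits w))))

vanishˡ : ∀ p q → + 0 *ᶻ p +ᶻ q ≡ q
vanishˡ = solve-∀

vanishʳ : ∀ p q → p *ᶻ + 0 +ᶻ q ≡ q
vanishʳ = solve-∀

unitˡ : ∀ p → + 1 *ᶻ p +ᶻ + 0 ≡ p
unitˡ = solve-∀

⊛-zeroˡ : ∀ (g : Series) → 𝟘 ⊛ g ≈ 𝟘
⊛-zeroˡ g [] = vanishˡ (g []) (+ 0)
⊛-zeroˡ g (c ∷ w) = trans (⊛-cons 𝟘 g c w) (trans (vanishˡ (g (c ∷ w)) _) (⊛-zeroˡ g w))

⊛-identityˡ : ∀ (f : Series) → 𝟙 ⊛ f ≈ f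
⊛-identityˡ f [] = unitˡ (f [])
⊛-identityˡ f (c ∷ w) = begin
    (𝟙 ⊛ f) (c ∷ w)                    ≡⟨ ⊛-cons 𝟙 f c w ⟩
    + 1 *ᶻ f (c ∷ w) +ᶻ (𝟘 ⊛ f) w       ≡⟨ cong (+ 1 *ᶻ f (c ∷ w) +ᶻ_) (⊛-zeroˡ f w) ⟩
    + 1 *ᶻ f (c ∷ w) +ᶻ + 0             ≡⟨ unitˡ (f (c ∷ w)) ⟩
    f (c ∷ w)                           ∎
  where open ≡-Reasoning

⊛-identityʳ : ∀ (f : Series) → f ⊛ 𝟙 ≈ f
⊛-identityʳ f [] = unitʳ (f [])
  where unitʳ : ∀ p → p *ᶻ + 1 +ᶻ + 0 ≡ p
        unitʳ = solve-∀
⊛-identityʳ f (c ∷ w) =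
  trans (⊛-cons f 𝟙 c w) (trans (cong (f [] *ᶻ + 0 +ᶻ_) (⊛-identityʳ (∂ c f) w)) (vanishʳ (f []) (f (c ∷ w))))

⊛-distribʳ-⊕ : ∀ (f g h : Series) → (f ⊕ g) ⊛ h ≈ f ⊛ h ⊕ g ⊛ h
⊛-distribʳ-⊕ f g h [] = lem (f []) (g []) (h [])
  where lem : ∀ p q r → (p +ᶻ q) *ᶻ r +ᶻ + 0 ≡ (p *ᶻ r +ᶻ + 0) +ᶻ (q *ᶻ r +ᶻ + 0)
        lem = solve-∀
⊛-distribʳ-⊕ f g h (c ∷ w)
  rewrite ⊛-cons (f ⊕ g) h c w | ⊛-cons f h c w | ⊛-cons g h c w | ⊛-distribʳ-⊕ (∂ c f) (∂ c g) h w
  = lem (f []) (g []) (h (c ∷ w)) _ _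
  where lem : ∀ p q r s t → (p +ᶻ q) *ᶻ r +ᶻ (s +ᶻ t) ≡ (p *ᶻ r +ᶻ s) +ᶻ (q *ᶻ r +ᶻ t)
        lem = solve-∀

⊛-distribʳ-⊖ : ∀ (f g h : Series) → (f ⊖ g) ⊛ h ≈ f ⊛ h ⊖ g ⊛ h
⊛-distribʳ-⊖ f g h [] = lem (f []) (g []) (h [])
  where lem : ∀ p q r → (p -ᶻ q) *ᶻ r +ᶻ + 0 ≡ (p *ᶻ r +ᶻ + 0) -ᶻ (q *ᶻ r +ᶻ + 0)
        lem = solve-∀
⊛-distribʳ-⊖ f g h (c ∷ w)
  rewrite ⊛-cons (f ⊖ g) h c w | ⊛-cons f h c w | ⊛-cons g h c w | ⊛-distribʳ-⊖ (∂ c f) (∂ c g) h w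
  = lem (f []) (g []) (h (c ∷ w)) _ _
  where lem : ∀ p q r s t → (p -ᶻ q) *ᶻ r +ᶻ (s -ᶻ t) ≡ (p *ᶻ r +ᶻ s) -ᶻ (q *ᶻ r +ᶻ t)
        lem = solve-∀

⊛-distribˡ-⊕ : ∀ (h f g : Series) → h ⊛ (f ⊕ g) ≈ h ⊛ f ⊕ h ⊛ g
⊛-distribˡ-⊕ h f g [] = lem (h []) (f []) (g [])
  where lem : ∀ p q r → p *ᶻ (q +ᶻ r) +ᶻ + 0 ≡ (p *ᶻ q +ᶻ + 0) +ᶻ (p *ᶻ r +ᶻ + 0)
        lem = solve-∀
⊛-distribˡ-⊕ h f g (c ∷ w)
  rewrite ⊛-cons h (f ⊕ g) c w | ⊛-cons h f c w | ⊛-cons h g c w | ⊛-distribˡ-⊕ (∂ c h) f g w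
  = lem (h []) (f (c ∷ w)) (g (c ∷ w)) _ _
  where lem : ∀ p q r s t → p *ᶻ (q +ᶻ r) +ᶻ (s +ᶻ t) ≡ (p *ᶻ q +ᶻ s) +ᶻ (p *ᶻ r +ᶻ t)
        lem = solve-∀

⊛-distribˡ-⊖ : ∀ (h f g : Series) → h ⊛ (f ⊖ g) ≈ h ⊛ f ⊖ h ⊛ g
⊛-distribˡ-⊖ h f g [] = lem (h []) (f []) (g [])
  where lem : ∀ p q r → p *ᶻ (q -ᶻ r) +ᶻ + 0 ≡ (p *ᶻ q +ᶻ + 0) -ᶻ (p *ᶻ r +ᶻ + 0)
        lem = solve-∀
⊛-distribˡ-⊖ h f g (c ∷ w)
  rewrite ⊛-cons h (f ⊖ g) c w | ⊛-cons h f c w | ⊛-cons h g c w | ⊛-distribˡ-⊖ (∂ c h) f g w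
  = lem (h []) (f (c ∷ w)) (g (c ∷ w)) _ _
  where lem : ∀ p q r s t → p *ᶻ (q -ᶻ r) +ᶻ (s -ᶻ t) ≡ (p *ᶻ q +ᶻ s) -ᶻ (p *ᶻ r +ᶻ t)
        lem = solve-∀

_·_ : ℤ → Series → Series
(s · f) w = s *ᶻ f w

⊛-scalarˡ : ∀ (s : ℤ) (f h : Series) → (s · f) ⊛ h ≈ s · (f ⊛ h)
⊛-scalarˡ s f h [] = lem s (f []) (h [])
  where lem : ∀ p q r → p *ᶻ q *ᶻ r +ᶻ + 0 ≡ p *ᶻ (q *ᶻ r +ᶻ + 0)
        lem = solve-∀
⊛-scalarˡ s f h (c ∷ w) rewrite ⊛-cons (s · f) h c w | ⊛-cons f h c w | ⊛-scalarˡ s (∂ c f) h w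
  = lem s (f []) (h (c ∷ w)) _
  where lem : ∀ p q r t → p *ᶻ q *ᶻ r +ᶻ p *ᶻ t ≡ p *ᶻ (q *ᶻ r +ᶻ t)
        lem = solve-∀

⊛-local : ∀ (f f' g g' : Series) w → (∀ u → length u ≤ length w → f u ≡ f' u)
  → (∀ u → length u ≤ length w → g u ≡ g' u) → (f ⊛ g) w ≡ (f' ⊛ g') w
⊛-local f f' g g' [] hf hg rewrite hf [] z≤n | hg [] z≤n = refl
⊛-local f f' g g' (c ∷ w) hf hg
  rewrite ⊛-cons f g c w | ⊛-cons f' g' c w | hf [] z≤n | hg (c ∷ w) NP.≤-refl
        | ⊛-local (∂ c f) (∂ c f') g g' w (λ u le → hf (c ∷ u) (s≤s le)) (λ u le → hg u (NP.m≤n⇒m≤1+n le))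
  = refl

⊛-cong : ∀ {f f' g g' : Series} → f ≈ f' → g ≈ g' → f ⊛ g ≈ f' ⊛ g'
⊛-cong {f} {f'} {g} {g'} p q w = ⊛-local f f' g g' w (λ u _ → p u) (λ u _ → q u)

⊛-congˡ : ∀ (h : Series) {f f' : Series} → f ≈ f' → f ⊛ h ≈ f' ⊛ h
⊛-congˡ h {f} {f'} p = ⊛-cong {f} {f'} {h} {h} p (λ _ → refl)

⊛-congʳ : ∀ (h : Series) {f f' : Series} → f ≈ f' → h ⊛ f ≈ h ⊛ f'
⊛-congʳ h {f} {f'} p = ⊛-cong {h} {h} {f} {f'} (λ _ → refl) p

⊕-cong : ∀ {f f' g g' : Series} → f ≈ f' → g ≈ g' → f ⊕ g ≈ f' ⊕ g'
⊕-cong p q w = cong₂ _+ᶻ_ (p w) (q w)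

⊖-cong : ∀ {f f' g g' : Series} → f ≈ f' → g ≈ g' → f ⊖ g ≈ f' ⊖ g'
⊖-cong p q w = cong₂ _-ᶻ_ (p w) (q w)

⊛-assoc : ∀ (f g h : Series) → (f ⊛ g) ⊛ h ≈ f ⊛ (g ⊛ h)
⊛-assoc f g h [] = lem (f []) (g []) (h [])
  where lem : ∀ p q r → (p *ᶻ q +ᶻ + 0) *ᶻ r +ᶻ + 0 ≡ p *ᶻ (q *ᶻ r +ᶻ + 0) +ᶻ + 0
        lem = solve-∀
⊛-assoc f g h (c ∷ w) = begin
    ((f ⊛ g) ⊛ h) (c ∷ w)
  ≡⟨ ⊛-cons (f ⊛ g) h c w ⟩
    (f ⊛ g) [] *ᶻ h (c ∷ w) +ᶻ (∂ c (f ⊛ g) ⊛ h) w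
  ≡⟨ cong ((f ⊛ g) [] *ᶻ h (c ∷ w) +ᶻ_) tail ⟩
    (f ⊛ g) [] *ᶻ h (c ∷ w) +ᶻ (f [] *ᶻ (∂ c g ⊛ h) w +ᶻ (∂ c f ⊛ (g ⊛ h)) w)
  ≡⟨ regroup (f []) (g []) (h (c ∷ w)) _ _ ⟩
    f [] *ᶻ (g [] *ᶻ h (c ∷ w) +ᶻ (∂ c g ⊛ h) w) +ᶻ (∂ c f ⊛ (g ⊛ h)) w
  ≡⟨ cong (λ z → f [] *ᶻ z +ᶻ (∂ c f ⊛ (g ⊛ h)) w) (sym (⊛-cons g h c w)) ⟩
    f [] *ᶻ (g ⊛ h) (c ∷ w) +ᶻ (∂ c f ⊛ (g ⊛ h)) w
  ≡⟨ sym (⊛-cons f (g ⊛ h) c w) ⟩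
    (f ⊛ (g ⊛ h)) (c ∷ w) ∎
  where
  open ≡-Reasoning
  regroup : ∀ p q r s t → (p *ᶻ q +ᶻ + 0) *ᶻ r +ᶻ (p *ᶻ s +ᶻ t) ≡ p *ᶻ (q *ᶻ r +ᶻ s) +ᶻ t
  regroup = solve-∀
  -- ∂c (f g) = f(ε) ∂c g + (∂c f) g, then induction on the shorter word.
  tail : (∂ c (f ⊛ g) ⊛ h) w ≡ f [] *ᶻ (∂ c g ⊛ h) w +ᶻ (∂ c f ⊛ (g ⊛ h)) w
  tail = begin
      (∂ c (f ⊛ g) ⊛ h) w
    ≡⟨ ⊛-congˡ h (⊛-cons f g c) w ⟩
      ((f [] · ∂ c g ⊕ ∂ c f ⊛ g) ⊛ h) w
    ≡⟨ ⊛-distribʳ-⊕ (f [] · ∂ c g) (∂ c f ⊛ g) h w ⟩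
      ((f [] · ∂ c g) ⊛ h) w +ᶻ ((∂ c f ⊛ g) ⊛ h) w
    ≡⟨ cong₂ _+ᶻ_ (⊛-scalarˡ (f []) (∂ c g) h w) (⊛-assoc (∂ c f) g h w) ⟩
      f [] *ᶻ (∂ c g ⊛ h) w +ᶻ (∂ c f ⊛ (g ⊛ h)) w ∎

module ≈-Reasoning = SetoidReasoning (Word →-setoid ℤ)

≈-sym : ∀ {f g : Series} → f ≈ g → g ≈ f
≈-sym p w = sym (p w)

infixr 5 _≈-∙_
_≈-∙_ : ∀ {f g h : Series} → f ≈ g → g ≈ h → f ≈ h
(p ≈-∙ q) w = trans (p w) (q w)

Agree : ℕ → Series → Series → Set
Agree n f g = ∀ u → length u < n → f u ≡ g u

Contractive : (Series → Series) → Set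
Contractive T = ∀ n f g → Agree n f g → Agree (suc n) (T f) (T g)

-- A contractive operator has a fixed point: its coefficient at w is the one
-- of the (|w|+1)-st iterate of T applied to 0, which no longer changes.
module FixedPoint (T : Series → Series) (contractive : Contractive T) where
  iterate : ℕ → Series
  iterate zero = 𝟘
  iterate (suc n) = T (iterate n)

  iterate-agree : ∀ n k → Agree n (iterate n) (iterate (n + k))
  iterate-agree zero k u ()
  iterate-agree (suc n) k = contractive n _ _ (iterate-agree n k)

  fix : Series
  fix w = iterate (suc (length w)) w

  fix-agree : ∀ n → Agree n fix (iterate n)
  fix-agree n u lt with NP.m≤n⇒∃[o]m+o≡n lt
  ... | k , refl = iterate-agree (suc (length u)) k u NP.≤-refl

  fix-eq : fix ≈ T fix
  fix-eq w = sym (contractive (length w) fix (iterate (length w)) (fix-agree (length w)) w NP.≤-refl)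

fixed-point-unique : ∀ (T : Series → Series) → Contractive T → ∀ f g → f ≈ T f → g ≈ T g → f ≈ g
fixed-point-unique T contractive f g f-fixed g-fixed w = agree (suc (length w)) w NP.≤-refl
  where
  agree : ∀ n → Agree n f g
  agree zero u ()
  agree (suc n) u lt = trans (f-fixed u) (trans (contractive n f g (agree n) u lt) (sym (g-fixed u)))

⊕-agree : ∀ {n f f' g g'} → Agree n f f' → Agree n g g' → Agree n (f ⊕ g) (f' ⊕ g')
⊕-agree p q u lt = cong₂ _+ᶻ_ (p u lt) (q u lt)

⊛-agree : ∀ {n} {f f' g g' : Series} → Agree n f f' → Agree n g g' → Agree n (f ⊛ g) (f' ⊛ g')
⊛-agree {f = f} {f'} {g} {g'} p q u lt =
  ⊛-local f f' g g' u (λ v le → p v (NP.≤-<-trans le lt)) (λ v le → q v (NP.≤-<-trans le lt))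

agree-refl : ∀ {n} (f : Series) → Agree n f f
agree-refl f u _ = refl

⊛-agree-shiftʳ : ∀ {n} (f : Series) {g g' : Series} → f [] ≡ + 0 → Agree n g g' → Agree (suc n) (f ⊛ g) (f ⊛ g')
⊛-agree-shiftʳ f {g} {g'} f₀ p [] _ rewrite f₀ = trans (vanishˡ (g []) (+ 0)) (sym (vanishˡ (g' []) (+ 0)))
⊛-agree-shiftʳ f {g} {g'} f₀ p (c ∷ w) lt
  rewrite ⊛-cons f g c w | ⊛-cons f g' c w | f₀ | vanishˡ (g (c ∷ w)) ((∂ c f ⊛ g) w)
        | vanishˡ (g' (c ∷ w)) ((∂ c f ⊛ g') w)
  = ⊛-agree (agree-refl (∂ c f)) (λ v lt' → p v (NP.<-≤-trans lt' (NP.≤-pred lt))) w NP.≤-refl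

⊛-agree-shiftˡ : ∀ {n} (g : Series) {f f' : Series} → g [] ≡ + 0 → Agree n f f' → Agree (suc n) (f ⊛ g) (f' ⊛ g)
⊛-agree-shiftˡ g {f} {f'} g₀ p [] _ rewrite g₀ = trans (vanishʳ (f []) (+ 0)) (sym (vanishʳ (f' []) (+ 0)))
⊛-agree-shiftˡ {zero} g g₀ p (c ∷ w) (s≤s ())
⊛-agree-shiftˡ {suc n} g {f} {f'} g₀ p (c ∷ w) lt
  rewrite ⊛-cons f g c w | ⊛-cons f' g c w | p [] (s≤s z≤n)
        | ⊛-agree-shiftˡ g {∂ c f} {∂ c f'} g₀ (λ v lt' → p (c ∷ v) (s≤s lt')) w (NP.≤-pred lt)
  = refl

letter : Letter → Series
letter c = mono (c ∷ [])

==L-refl : ∀ c → (c ==L c) ≡ true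
==L-refl a = refl
==L-refl b = refl
==L-refl x = refl

letter-⊛-nil : ∀ c (f : Series) → (letter c ⊛ f) [] ≡ + 0
letter-⊛-nil c f = vanishˡ (f []) (+ 0)

letter-⊛-cons : ∀ c d (f : Series) w → (letter c ⊛ f) (d ∷ w) ≡ (if c ==L d then f w else + 0)
letter-⊛-cons c d f w =
  trans (⊛-cons (letter c) f d w) (trans (vanishˡ (f (d ∷ w)) _) (derivative c d))
  where
  derivative : ∀ c d → (∂ d (letter c) ⊛ f) w ≡ (if c ==L d then f w else + 0)
  derivative a a = ⊛-identityˡ f w
  derivative a b = ⊛-zeroˡ f w
  derivative a x = ⊛-zeroˡ f w
  derivative b a = ⊛-zeroˡ f w
  derivative b b = ⊛-identityˡ f w
  derivative b x = ⊛-zeroˡ f w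
  derivative x a = ⊛-zeroˡ f w
  derivative x b = ⊛-zeroˡ f w
  derivative x x = ⊛-identityˡ f w

letter-⊛-same : ∀ c (f : Series) w → (letter c ⊛ f) (c ∷ w) ≡ f w
letter-⊛-same c f w rewrite letter-⊛-cons c c f w | ==L-refl c = refl

letter-long : ∀ c d w → letter c (d ∷ w ++ c ∷ []) ≡ + 0
letter-long c d [] rewrite ∧-zeroʳ (c ==L d) = refl
letter-long c d (_ ∷ _) rewrite ∧-zeroʳ (c ==L d) = refl

⊛-letter-snoc : ∀ (h : Series) c w → (h ⊛ letter c) (w ++ c ∷ []) ≡ h w
⊛-letter-snoc h c [] rewrite ==L-refl c = lem (h []) (h (c ∷ []))
  where lem : ∀ p q → p *ᶻ + 1 +ᶻ (q *ᶻ + 0 +ᶻ + 0) ≡ p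
        lem = solve-∀
⊛-letter-snoc h c (d ∷ w)
  rewrite ⊛-cons h (letter c) d (w ++ c ∷ []) | letter-long c d w | ⊛-letter-snoc (∂ d h) c w
  = vanishʳ (h []) (h (d ∷ w))

sandwich-injective : ∀ {f g : Series} → sandwich f ≈ sandwich g → f ≈ g
sandwich-injective {f} {g} eq w = begin
  f w                                 ≡⟨ sym (letter-⊛-same a f w) ⟩
  (A ⊛ f) (a ∷ w)                     ≡⟨ sym (⊛-letter-snoc (A ⊛ f) b (a ∷ w)) ⟩
  sandwich f ((a ∷ w) ++ b ∷ [])      ≡⟨ eq ((a ∷ w) ++ b ∷ []) ⟩
  sandwich g ((a ∷ w) ++ b ∷ [])      ≡⟨ ⊛-letter-snoc (A ⊛ g) b (a ∷ w) ⟩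
  (A ⊛ g) (a ∷ w)                     ≡⟨ letter-⊛-same a g w ⟩
  g w                                 ∎
  where open ≡-Reasoning

-- dyckFrom k v: v is a path of up-steps a and down-steps b from height k to
-- height 0 that never goes below 0.  Dyck words are the paths from height 0.
dyckFrom : ℕ → Word → Bool
dyckFrom k [] = k ≡ᵇ 0
dyckFrom k (a ∷ v) = dyckFrom (suc k) v
dyckFrom zero (b ∷ v) = false
dyckFrom (suc k) (b ∷ v) = dyckFrom k v
dyckFrom k (x ∷ v) = false

allB-map : ∀ {X Y : Set} (p : Y → Bool) (f : X → Y) l → allB p (map f l) ≡ allB (p ∘ f) l
allB-map p f [] = refl
allB-map p f (y ∷ l) = cong (p (f y) ∧_) (allB-map p f l)

allB-cong : ∀ {X : Set} (p q : X → Bool) → (∀ y → p y ≡ q y) → ∀ l → allB p l ≡ allB q l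
allB-cong p q h [] = refl
allB-cong p q h (y ∷ l) = cong₂ _∧_ (h y) (allB-cong p q h l)

dyckTest : ℕ → Word → Bool
dyckTest k v = allB isAB v ∧ ((k + count a v) ≡ᵇ count b v)
             ∧ allB (λ p → count b p ≤ᵇ k + count a p) (inits v)

dyckTest-stepwise : ∀ k v → dyckTest k v ≡ dyckFrom k v
dyckTest-stepwise zero [] = refl
dyckTest-stepwise (suc k) [] = refl
dyckTest-stepwise k (a ∷ v) = trans
  (cong₂ (λ z y → allB isAB v ∧ (z ≡ᵇ count b v) ∧ y) (NP.+-suc k (count a v))
    (trans (allB-map (λ p → count b p ≤ᵇ k + count a p) (a ∷_) (inits v))
           (allB-cong _ _ (λ p → cong (count b p ≤ᵇ_) (NP.+-suc k (count a p))) (inits v))))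
  (dyckTest-stepwise (suc k) v)
dyckTest-stepwise zero (b ∷ v) = trans (cong (allB isAB v ∧_) (∧-zeroʳ _)) (∧-zeroʳ _)
dyckTest-stepwise (suc k) (b ∷ v) = trans
  (cong (λ y → allB isAB v ∧ ((k + count a v) ≡ᵇ count b v) ∧ y)
    (trans (allB-map (λ p → count b p ≤ᵇ suc k + count a p) (b ∷_) (inits v))
           (allB-cong _ _ (λ p → suc≤ᵇsuc (count b p) (k + count a p)) (inits v))))
  (dyckTest-stepwise k v)
  where suc≤ᵇsuc : ∀ m n → (suc m ≤ᵇ suc n) ≡ (m ≤ᵇ n)
        suc≤ᵇsuc zero n = refl
        suc≤ᵇsuc (suc m) n = refl
dyckTest-stepwise k (x ∷ v) = refl

countWhere : (Word → Bool) → List Word → ℕ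
countWhere p l = length (filterᵇ p l)

countWhere-++ : ∀ p l₁ l₂ → countWhere p (l₁ ++ l₂) ≡ countWhere p l₁ + countWhere p l₂
countWhere-++ p [] l₂ = refl
countWhere-++ p (v ∷ l₁) l₂ with p v
... | true = cong suc (countWhere-++ p l₁ l₂)
... | false = countWhere-++ p l₁ l₂

countWhere-map : ∀ p (f : Word → Word) l → countWhere p (map f l) ≡ countWhere (p ∘ f) l
countWhere-map p f [] = refl
countWhere-map p f (v ∷ l) with p (f v)
... | true = cong suc (countWhere-map p f l)
... | false = countWhere-map p f l

countWhere-cong : ∀ p q → (∀ v → p v ≡ q v) → ∀ l → countWhere p l ≡ countWhere q l
countWhere-cong p q h [] = refl
countWhere-cong p q h (v ∷ l) with p v | q v | h v
... | true | .true | refl = cong suc (countWhere-cong p q h l)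
... | false | .false | refl = countWhere-cong p q h l

countWhere-none : ∀ p → (∀ v → p v ≡ false) → ∀ l → countWhere p l ≡ 0
countWhere-none p h [] = refl
countWhere-none p h (v ∷ l) with p v | h v
... | false | refl = countWhere-none p h l

countWhere-abWords : ∀ p n → countWhere p (abWords (suc n))
                   ≡ countWhere (λ v → p (a ∷ v)) (abWords n) + countWhere (λ v → p (b ∷ v)) (abWords n)
countWhere-abWords p n = trans (countWhere-++ p (map (a ∷_) (abWords n)) (map (b ∷_) (abWords n)))
  (cong₂ _+_ (countWhere-map p (a ∷_) (abWords n)) (countWhere-map p (b ∷_) (abWords n)))

-- preimages k w: the number of Dyck paths from height k whose ab-contraction
-- (replaceAB) is w.  Reading w from the left, x is a contracted ab, b a
-- down-step, and a an up-step that must not be followed by b (that ab would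
-- have been contracted).
preimages : ℕ → Word → ℕ
preimages k [] = if k ≡ᵇ 0 then 1 else 0
preimages k (x ∷ w) = preimages k w
preimages zero (b ∷ w) = 0
preimages (suc k) (b ∷ w) = preimages k w
preimages k (a ∷ []) = preimages (suc k) []
preimages k (a ∷ b ∷ w) = 0
preimages k (a ∷ a ∷ w) = preimages (suc k) (a ∷ w)
preimages k (a ∷ x ∷ w) = preimages (suc k) (x ∷ w)

-- The common length of all preimages of w: an x expands to two letters.
expandedLength : Word → ℕ
expandedLength [] = 0
expandedLength (a ∷ w) = suc (expandedLength w)
expandedLength (b ∷ w) = suc (expandedLength w)
expandedLength (x ∷ w) = suc (suc (expandedLength w))

-- The preimages are among the lengths ≤ 2|w| summed over in the definition of D.
expandedLength-bound : ∀ w → expandedLength w ≤ 2 * length w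
expandedLength-bound [] = z≤n
expandedLength-bound (c ∷ w) rewrite NP.*-suc 2 (length w) = step c
  where
  bound : expandedLength w ≤ 2 * length w
  bound = expandedLength-bound w
  step : ∀ c → expandedLength (c ∷ w) ≤ 2 + 2 * length w
  step a = s≤s (NP.m≤n⇒m≤1+n bound)
  step b = s≤s (NP.m≤n⇒m≤1+n bound)
  step x = s≤s (s≤s bound)

preimagesOfLength : ℕ → ℕ → Word → ℕ
preimagesOfLength n k w = if n ≡ᵇ expandedLength w then preimages k w else 0

-- The number of paths v of length n from height k for which a v contracts to w.
preimagesAfterA : ℕ → ℕ → Word → ℕ
preimagesAfterA n k (a ∷ []) = preimagesOfLength n k []
preimagesAfterA n k (a ∷ a ∷ w) = preimagesOfLength n k (a ∷ w)
preimagesAfterA n k (a ∷ x ∷ w) = preimagesOfLength n k (x ∷ w)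
preimagesAfterA (suc n) (suc k) (x ∷ w) = preimagesOfLength n k w
preimagesAfterA _ _ _ = 0

preimagesOfLengthBelow : ℕ → ℕ → Word → ℕ
preimagesOfLengthBelow n zero t = 0
preimagesOfLengthBelow n (suc k) t = preimagesOfLength n k t

IsPreimage : ℕ → Word → Word → Bool
IsPreimage k w v = dyckFrom k v ∧ (replaceAB v ==W w)

IsPreimageAfterA : ℕ → Word → Word → Bool
IsPreimageAfterA k w v = dyckFrom k v ∧ (replaceAB (a ∷ v) ==W w)

if-same : ∀ (c : Bool) → (if c then 0 else 0) ≡ 0
if-same true = refl
if-same false = refl

peel-a : ∀ n k t → preimagesOfLength (suc n) k (a ∷ t) ≡ preimagesAfterA n (suc k) (a ∷ t)
peel-a n k [] = refl
peel-a n k (b ∷ t) = if-same _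
peel-a n k (a ∷ t) = refl
peel-a n k (x ∷ t) = refl

peel-x : ∀ n k t → preimagesOfLength (suc n) k (x ∷ t) ≡ preimagesAfterA n (suc k) (x ∷ t)
peel-x zero k t = refl
peel-x (suc n) k t = refl

none : ∀ n p → (∀ v → p v ≡ false) → countWhere p (abWords n) ≡ 0
none n p h = countWhere-none p h (abWords n)

count-preimages : ∀ n k w → countWhere (IsPreimage k w) (abWords n) ≡ preimagesOfLength n k w
count-preimages-after-a : ∀ n k w → countWhere (IsPreimageAfterA k w) (abWords n) ≡ preimagesAfterA n k w

count-preimages zero zero [] = refl
count-preimages zero (suc k) [] = refl
count-preimages zero zero (a ∷ w) = refl
count-preimages zero zero (b ∷ w) = refl
count-preimages zero zero (x ∷ w) = refl
count-preimages zero (suc k) (a ∷ w) = refl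
count-preimages zero (suc k) (b ∷ w) = refl
count-preimages zero (suc k) (x ∷ w) = refl
count-preimages (suc n) k w =
  trans (countWhere-abWords (IsPreimage k w) n)
        (trans (cong₂ _+_ (count-preimages-after-a n (suc k) w) (startsWith-b k w)) (combine k w))
  where
  afterB : ℕ → Word → ℕ
  afterB k (b ∷ t) = preimagesOfLengthBelow n k t
  afterB _ _ = 0
  startsWith-b : ∀ k w → countWhere (λ v → IsPreimage k w (b ∷ v)) (abWords n) ≡ afterB k w
  startsWith-b k [] = none n _ (λ v → ∧-zeroʳ _)
  startsWith-b k (a ∷ t) = none n _ (λ v → ∧-zeroʳ _)
  startsWith-b zero (b ∷ t) = none n _ (λ v → refl)
  startsWith-b (suc k) (b ∷ t) = count-preimages n k t
  startsWith-b k (x ∷ t) = none n _ (λ v → ∧-zeroʳ _)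
  combine : ∀ k w → preimagesAfterA n (suc k) w + afterB k w ≡ preimagesOfLength (suc n) k w
  combine k [] = refl
  combine k (a ∷ t) = trans (NP.+-identityʳ _) (sym (peel-a n k t))
  combine zero (b ∷ t) = sym (if-same _)
  combine (suc k) (b ∷ t) = refl
  combine k (x ∷ t) = trans (NP.+-identityʳ _) (sym (peel-x n k t))

count-preimages-after-a zero zero [] = refl
count-preimages-after-a zero (suc k) [] = refl
count-preimages-after-a zero zero (a ∷ []) = refl
count-preimages-after-a zero (suc k) (a ∷ []) = refl
count-preimages-after-a zero zero (a ∷ a ∷ w) = refl
count-preimages-after-a zero zero (a ∷ b ∷ w) = refl
count-preimages-after-a zero zero (a ∷ x ∷ w) = refl
count-preimages-after-a zero (suc k) (a ∷ a ∷ w) = refl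
count-preimages-after-a zero (suc k) (a ∷ b ∷ w) = refl
count-preimages-after-a zero (suc k) (a ∷ x ∷ w) = refl
count-preimages-after-a zero zero (b ∷ w) = refl
count-preimages-after-a zero (suc k) (b ∷ w) = refl
count-preimages-after-a zero zero (x ∷ w) = refl
count-preimages-after-a zero (suc k) (x ∷ w) = refl
count-preimages-after-a (suc n) k w =
  trans (countWhere-abWords (IsPreimageAfterA k w) n)
        (trans (cong₂ _+_ (startsWith-a k w) (startsWith-b k w)) (combine k w))
  where
  afterA : ℕ → Word → ℕ
  afterA k (a ∷ t) = preimagesAfterA n (suc k) t
  afterA _ _ = 0
  startsWith-a : ∀ k w → countWhere (λ v → IsPreimageAfterA k w (a ∷ v)) (abWords n) ≡ afterA k w
  startsWith-a k [] = none n _ (λ v → ∧-zeroʳ _)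
  startsWith-a k (a ∷ t) = count-preimages-after-a n (suc k) t
  startsWith-a k (b ∷ t) = none n _ (λ v → ∧-zeroʳ _)
  startsWith-a k (x ∷ t) = none n _ (λ v → ∧-zeroʳ _)
  -- after a, a down-step b is contracted with it into x
  afterAB : ℕ → Word → ℕ
  afterAB k (x ∷ t) = preimagesOfLengthBelow n k t
  afterAB _ _ = 0
  startsWith-b : ∀ k w → countWhere (λ v → IsPreimageAfterA k w (b ∷ v)) (abWords n) ≡ afterAB k w
  startsWith-b k [] = none n _ (λ v → ∧-zeroʳ _)
  startsWith-b k (a ∷ t) = none n _ (λ v → ∧-zeroʳ _)
  startsWith-b k (b ∷ t) = none n _ (λ v → ∧-zeroʳ _)
  startsWith-b zero (x ∷ t) = none n _ (λ v → refl)
  startsWith-b (suc k) (x ∷ t) = count-preimages n k t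
  combine : ∀ k w → afterA k w + afterAB k w ≡ preimagesAfterA (suc n) k w
  combine k [] = refl
  combine k (a ∷ []) = NP.+-identityʳ _
  combine k (a ∷ b ∷ t) = refl
  combine k (a ∷ a ∷ t) = trans (NP.+-identityʳ _) (sym (peel-a n k t))
  combine k (a ∷ x ∷ t) = trans (NP.+-identityʳ _) (sym (peel-x n k t))
  combine k (b ∷ t) = refl
  combine zero (x ∷ t) = refl
  combine (suc k) (x ∷ t) = refl

sum-single : ∀ L m c → L < m → sum (applyUpTo (λ n → if n ≡ᵇ L then c else 0) m) ≡ c
sum-single zero (suc m) c _ = trans (cong (λ s → c + s) (sum-zeros m)) (NP.+-identityʳ c)
  where sum-zeros : ∀ m → sum (applyUpTo (λ _ → 0) m) ≡ 0
        sum-zeros zero = refl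
        sum-zeros (suc m) = sum-zeros m
sum-single (suc L) (suc m) c (s≤s lt) = sum-single L m c lt

map-upTo : ∀ (g : ℕ → ℕ) m → map g (upTo m) ≡ applyUpTo g m
map-upTo g m = go id m
  where go : ∀ (h : ℕ → ℕ) m → map g (applyUpTo h m) ≡ applyUpTo (g ∘ h) m
        go h zero = refl
        go h (suc m) = cong (g (h 0) ∷_) (go (h ∘ suc) m)

D[_] : ℕ → Series
D[ k ] w = + preimages k w

-- D is D_0: of the lengths n ≤ 2|w| summed over in the definition of D, only
-- n = expandedLength w contributes.
D-is-D₀ : D ≈ D[ 0 ]
D-is-D₀ w = cong +_ (begin
    sum (map (λ n → countWhere (λ v → isDyck v ∧ (replaceAB v ==W w)) (abWords n)) (upTo bound))
  ≡⟨ cong sum (LP.map-cong (λ n → trans (countWhere-cong _ _ isDyck-stepwise (abWords n))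
                                        (count-preimages n 0 w)) (upTo bound)) ⟩
    sum (map (λ n → preimagesOfLength n 0 w) (upTo bound))
  ≡⟨ cong sum (map-upTo (λ n → preimagesOfLength n 0 w) bound) ⟩
    sum (applyUpTo (λ n → preimagesOfLength n 0 w) bound)
  ≡⟨ sum-single (expandedLength w) bound (preimages 0 w) (s≤s (expandedLength-bound w)) ⟩
    preimages 0 w ∎)
  where
  open ≡-Reasoning
  bound : ℕ
  bound = suc (2 * length w)
  isDyck-stepwise : ∀ v → (isDyck v ∧ (replaceAB v ==W w)) ≡ IsPreimage 0 w v
  isDyck-stepwise v = cong (_∧ (replaceAB v ==W w)) (dyckTest-stepwise 0 v)

-- An up-step a not followed by b raises the starting height of the remaining path.
up-step : ∀ m k c w → ∂ c (∂ a D[ m ]) ≈ ∂ c D[ suc m ]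
  → (D[ m ] ⊛ (B ⊛ D[ k ])) (a ∷ c ∷ w) ≡ (D[ suc m ] ⊛ (B ⊛ D[ k ])) (c ∷ w)
up-step m k c w same = begin
    (D[ m ] ⊛ g) (a ∷ c ∷ w)
  ≡⟨ ⊛-cons D[ m ] g a (c ∷ w) ⟩
    D[ m ] [] *ᶻ g (a ∷ c ∷ w) +ᶻ (∂ a D[ m ] ⊛ g) (c ∷ w)
  ≡⟨ cong₂ (λ p q → D[ m ] [] *ᶻ p +ᶻ q) (letter-⊛-cons b a D[ k ] (c ∷ w)) (⊛-cons (∂ a D[ m ]) g c w) ⟩
    D[ m ] [] *ᶻ + 0 +ᶻ (D[ suc m ] [] *ᶻ g (c ∷ w) +ᶻ (∂ c (∂ a D[ m ]) ⊛ g) w)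
  ≡⟨ vanishʳ (D[ m ] []) _ ⟩
    D[ suc m ] [] *ᶻ g (c ∷ w) +ᶻ (∂ c (∂ a D[ m ]) ⊛ g) w
  ≡⟨ cong (D[ suc m ] [] *ᶻ g (c ∷ w) +ᶻ_) (⊛-congˡ g same w) ⟩
    D[ suc m ] [] *ᶻ g (c ∷ w) +ᶻ (∂ c D[ suc m ] ⊛ g) w
  ≡⟨ sym (⊛-cons D[ suc m ] g c w) ⟩
    (D[ suc m ] ⊛ g) (c ∷ w) ∎
  where
  open ≡-Reasoning
  g : Series
  g = B ⊛ D[ k ]

-- First-passage decomposition: a path from height m+k+1 splits uniquely at its
-- first step down to height k into a path from height m (read relative to
-- height k+1), that step b, and a path from height k.
first-passage : ∀ m k → D[ m ] ⊛ (B ⊛ D[ k ]) ≈ D[ suc (m + k) ]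
first-passage m k [] rewrite letter-⊛-nil b D[ k ] = vanishʳ (D[ m ] []) (+ 0)
first-passage m k (x ∷ w)
  rewrite ⊛-cons D[ m ] (B ⊛ D[ k ]) x w | letter-⊛-cons b x D[ k ] w | first-passage m k w
  = vanishʳ (D[ m ] []) _
first-passage zero k (b ∷ w)
  rewrite ⊛-cons D[ zero ] (B ⊛ D[ k ]) b w | letter-⊛-cons b b D[ k ] w | ⊛-zeroˡ (B ⊛ D[ k ]) w
  = unitˡ _
first-passage (suc m) k (b ∷ w) rewrite ⊛-cons D[ suc m ] (B ⊛ D[ k ]) b w | first-passage m k w
  = vanishˡ (D[ k ] w) _
first-passage m k (a ∷ [])
  rewrite ⊛-cons D[ m ] (B ⊛ D[ k ]) a [] | letter-⊛-cons b a D[ k ] [] | letter-⊛-nil b D[ k ]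
  = vanishʳ (D[ m ] []) (+ 0 *ᶻ + 0 +ᶻ + 0)
first-passage m k (a ∷ b ∷ w)
  rewrite ⊛-cons D[ m ] (B ⊛ D[ k ]) a (b ∷ w) | letter-⊛-cons b a D[ k ] (b ∷ w)
        | ⊛-cons (∂ a D[ m ]) (B ⊛ D[ k ]) b w | ⊛-zeroˡ (B ⊛ D[ k ]) w
  = trans (vanishʳ (D[ m ] []) _) (vanishˡ ((B ⊛ D[ k ]) (b ∷ w)) (+ 0))
first-passage m k (a ∷ a ∷ w) = trans (up-step m k a w (λ _ → refl)) (first-passage (suc m) k (a ∷ w))
first-passage m k (a ∷ x ∷ w) = trans (up-step m k x w (λ _ → refl)) (first-passage (suc m) k (x ∷ w))

-- Reading the first letter of a contraction of a Dyck path: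
-- D₀ = 1 + x D₀ + a (D₁ - b D₀), since an a followed by b is never left uncontracted.
D₀-first-letter : D[ 0 ] ⊖ (X ⊛ D[ 0 ] ⊖ A ⊛ (B ⊛ D[ 0 ])) ⊖ A ⊛ D[ 1 ] ≈ 𝟙
D₀-first-letter [] rewrite letter-⊛-nil x D[ 0 ] | letter-⊛-nil a (B ⊛ D[ 0 ]) | letter-⊛-nil a D[ 1 ] = refl
D₀-first-letter (b ∷ t)
  rewrite letter-⊛-cons x b D[ 0 ] t | letter-⊛-cons a b (B ⊛ D[ 0 ]) t | letter-⊛-cons a b D[ 1 ] t = refl
D₀-first-letter (x ∷ t)
  rewrite letter-⊛-cons x x D[ 0 ] t | letter-⊛-cons a x (B ⊛ D[ 0 ]) t | letter-⊛-cons a x D[ 1 ] t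
  = lem (D[ 0 ] t)
  where lem : ∀ y → y -ᶻ (y -ᶻ + 0) -ᶻ + 0 ≡ + 0
        lem = solve-∀
D₀-first-letter (a ∷ t)
  rewrite letter-⊛-cons x a D[ 0 ] t | letter-⊛-cons a a (B ⊛ D[ 0 ]) t | letter-⊛-cons a a D[ 1 ] t
  = after-a t
  where
  cancel : ∀ y → y -ᶻ (+ 0 -ᶻ + 0) -ᶻ y ≡ + 0
  cancel = solve-∀
  after-a : ∀ t → D[ 0 ] (a ∷ t) -ᶻ (+ 0 -ᶻ (B ⊛ D[ 0 ]) t) -ᶻ D[ 1 ] t ≡ + 0
  after-a [] rewrite letter-⊛-nil b D[ 0 ] = refl
  after-a (b ∷ t) rewrite letter-⊛-cons b b D[ 0 ] t = lem (D[ 0 ] t)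
    where lem : ∀ y → + 0 -ᶻ (+ 0 -ᶻ y) -ᶻ y ≡ + 0
          lem = solve-∀
  after-a (a ∷ t) rewrite letter-⊛-cons b a D[ 0 ] t = cancel (D[ 1 ] (a ∷ t))
  after-a (x ∷ t) rewrite letter-⊛-cons b x D[ 0 ] t = cancel (D[ 1 ] (x ∷ t))

D-equation : (𝟙 ⊖ (X ⊖ A ⊛ B) ⊖ sandwich D) ⊛ D ≈ 𝟙
D-equation = begin
    (𝟙 ⊖ (X ⊖ A ⊛ B) ⊖ sandwich D) ⊛ D
  ≈⟨ ⊛-distribʳ-⊖ (𝟙 ⊖ (X ⊖ A ⊛ B)) (sandwich D) D ⟩
    (𝟙 ⊖ (X ⊖ A ⊛ B)) ⊛ D ⊖ sandwich D ⊛ D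
  ≈⟨ ⊖-cong (⊛-distribʳ-⊖ 𝟙 (X ⊖ A ⊛ B) D) (λ _ → refl) ⟩
    𝟙 ⊛ D ⊖ (X ⊖ A ⊛ B) ⊛ D ⊖ sandwich D ⊛ D
  ≈⟨ ⊖-cong (⊖-cong (⊛-identityˡ D) (⊛-distribʳ-⊖ X (A ⊛ B) D)) aDbD ⟩
    D ⊖ (X ⊛ D ⊖ A ⊛ B ⊛ D) ⊖ A ⊛ D[ 1 ]
  ≈⟨ ⊖-cong (⊖-cong D-is-D₀ (⊖-cong (⊛-congʳ X D-is-D₀)
                                   (⊛-assoc A B D ≈-∙ ⊛-congʳ A (⊛-congʳ B D-is-D₀)))) (λ _ → refl) ⟩
    D[ 0 ] ⊖ (X ⊛ D[ 0 ] ⊖ A ⊛ (B ⊛ D[ 0 ])) ⊖ A ⊛ D[ 1 ]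
  ≈⟨ D₀-first-letter ⟩
    𝟙 ∎
  where
  open ≈-Reasoning
  aDbD : sandwich D ⊛ D ≈ A ⊛ D[ 1 ]
  aDbD = begin
      A ⊛ D ⊛ B ⊛ D            ≈⟨ ⊛-assoc (A ⊛ D) B D ⟩
      A ⊛ D ⊛ (B ⊛ D)          ≈⟨ ⊛-assoc A D (B ⊛ D) ⟩
      A ⊛ (D ⊛ (B ⊛ D))        ≈⟨ ⊛-congʳ A (⊛-cong D-is-D₀ (⊛-congʳ B D-is-D₀)) ⟩
      A ⊛ (D[ 0 ] ⊛ (B ⊛ D[ 0 ])) ≈⟨ ⊛-congʳ A (first-passage 0 0) ⟩
      A ⊛ D[ 1 ]               ∎

⊛-one-plus : ∀ (F S : Series) → F ⊛ (𝟙 ⊕ S) ≈ F ⊕ F ⊛ S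
⊛-one-plus F S w = trans (⊛-distribˡ-⊕ F 𝟙 S w) (cong (_+ᶻ (F ⊛ S) w) (⊛-identityʳ F w))

one-minus-⊛ : ∀ (F Y : Series) → (𝟙 ⊖ F) ⊛ Y ≈ Y ⊖ F ⊛ Y
one-minus-⊛ F Y w = trans (⊛-distribʳ-⊖ 𝟙 F Y w) (cong (_-ᶻ (F ⊛ Y) w) (⊛-identityˡ Y w))

one-minus-⊛-one-plus : ∀ (F S : Series) → (𝟙 ⊖ F) ⊛ (𝟙 ⊕ S) ≈ 𝟙 ⊕ S ⊖ (F ⊕ F ⊛ S)
one-minus-⊛-one-plus F S = one-minus-⊛ F (𝟙 ⊕ S) ≈-∙ ⊖-cong {𝟙 ⊕ S} {𝟙 ⊕ S} (λ _ → refl) (⊛-one-plus F S)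

inverse-of-geometric : ∀ (F S : Series) → S ≈ F ⊕ F ⊛ S → (𝟙 ⊖ F) ⊛ (𝟙 ⊕ S) ≈ 𝟙
inverse-of-geometric F S geometric w rewrite one-minus-⊛-one-plus F S w | geometric w =
  lem (𝟙 w) (F w) ((F ⊛ S) w)
  where lem : ∀ o e t → o +ᶻ (e +ᶻ t) -ᶻ (e +ᶻ t) ≡ o
        lem = solve-∀

geometric-of-inverse : ∀ (F S : Series) → (𝟙 ⊖ F) ⊛ (𝟙 ⊕ S) ≈ 𝟙 → S ≈ F ⊕ F ⊛ S
geometric-of-inverse F S inverse w =
  lem (𝟙 w) (S w) ((F ⊕ F ⊛ S) w) (trans (sym (one-minus-⊛-one-plus F S w)) (inverse w))
  where lem : ∀ o s r → o +ᶻ s -ᶻ r ≡ o → s ≡ r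
        lem o s r eq = trans (shift o s r) (trans (cong (λ z → z -ᶻ o +ᶻ r) eq) (cancel o r))
          where shift : ∀ o s r → s ≡ o +ᶻ s -ᶻ r -ᶻ o +ᶻ r
                shift = solve-∀
                cancel : ∀ o r → o -ᶻ o +ᶻ r ≡ r
                cancel = solve-∀

right-inverse-is-left-inverse : ∀ {L M R : Series} → L ⊛ M ≈ 𝟙 → M ⊛ R ≈ 𝟙 → R ⊛ M ≈ 𝟙
right-inverse-is-left-inverse {L} {M} {R} left right = begin
    R ⊛ M          ≈⟨ ⊛-congˡ M R≈L ⟩
    L ⊛ M          ≈⟨ left ⟩
    𝟙              ∎
  where
  open ≈-Reasoning
  R≈L : R ≈ L
  R≈L = begin
    R              ≈⟨ ≈-sym (⊛-identityˡ R) ⟩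
    𝟙 ⊛ R          ≈⟨ ⊛-congˡ R (≈-sym left) ⟩
    L ⊛ M ⊛ R      ≈⟨ ⊛-assoc L M R ⟩
    L ⊛ (M ⊛ R)    ≈⟨ ⊛-congʳ L right ⟩
    L ⊛ 𝟙          ≈⟨ ⊛-identityʳ L ⟩
    L              ∎

left-inverse : ∀ (F : Series) → F [] ≡ + 0 → Σ Series (λ L → L ⊛ (𝟙 ⊖ F) ≈ 𝟙)
left-inverse F F₀ = L , inverse
  where
  step : Series → Series
  step Z = 𝟙 ⊕ Z ⊛ F
  contractive : Contractive step
  contractive n Z Z' agree = ⊕-agree (agree-refl 𝟙) (⊛-agree-shiftˡ F F₀ agree)
  open FixedPoint step contractive renaming (fix to L; fix-eq to L-fixed)
  inverse : L ⊛ (𝟙 ⊖ F) ≈ 𝟙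
  inverse w rewrite ⊛-distribˡ-⊖ L 𝟙 F w | ⊛-identityʳ L w | L-fixed w = lem (𝟙 w) ((L ⊛ F) w)
    where lem : ∀ o t → o +ᶻ t -ᶻ t ≡ o
          lem = solve-∀

right-inverse-two-sided : ∀ (F R : Series) → F [] ≡ + 0 → (𝟙 ⊖ F) ⊛ R ≈ 𝟙 → R ⊛ (𝟙 ⊖ F) ≈ 𝟙
right-inverse-two-sided F R F₀ right with left-inverse F F₀
... | L , left = right-inverse-is-left-inverse {L} {𝟙 ⊖ F} {R} left right

sandwich-expand : ∀ (G Z : Series) → sandwich (G ⊕ G ⊛ (B ⊛ A ⊛ Z)) ≈ sandwich G ⊕ sandwich G ⊛ sandwich Z
sandwich-expand G Z = begin
    A ⊛ (G ⊕ G ⊛ (B ⊛ A ⊛ Z)) ⊛ B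
  ≈⟨ ⊛-congˡ B (⊛-distribˡ-⊕ A G (G ⊛ (B ⊛ A ⊛ Z))) ⟩
    (A ⊛ G ⊕ A ⊛ (G ⊛ (B ⊛ A ⊛ Z))) ⊛ B
  ≈⟨ ⊛-distribʳ-⊕ (A ⊛ G) (A ⊛ (G ⊛ (B ⊛ A ⊛ Z))) B ⟩
    A ⊛ G ⊛ B ⊕ A ⊛ (G ⊛ (B ⊛ A ⊛ Z)) ⊛ B
  ≈⟨ ⊕-cong {A ⊛ G ⊛ B} {A ⊛ G ⊛ B} (λ _ → refl) regroup ⟩
    A ⊛ G ⊛ B ⊕ A ⊛ G ⊛ B ⊛ (A ⊛ Z ⊛ B) ∎
  where
  open ≈-Reasoning
  regroup : A ⊛ (G ⊛ (B ⊛ A ⊛ Z)) ⊛ B ≈ A ⊛ G ⊛ B ⊛ (A ⊛ Z ⊛ B)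
  regroup = begin
      A ⊛ (G ⊛ (B ⊛ A ⊛ Z)) ⊛ B    ≈⟨ ⊛-assoc A (G ⊛ (B ⊛ A ⊛ Z)) B ⟩
      A ⊛ (G ⊛ (B ⊛ A ⊛ Z) ⊛ B)    ≈⟨ ⊛-congʳ A (⊛-assoc G (B ⊛ A ⊛ Z) B) ⟩
      A ⊛ (G ⊛ (B ⊛ A ⊛ Z ⊛ B))    ≈⟨ ⊛-congʳ A (⊛-congʳ G (⊛-congˡ B (⊛-assoc B A Z) ≈-∙ ⊛-assoc B (A ⊛ Z) B)) ⟩
      A ⊛ (G ⊛ (B ⊛ (A ⊛ Z ⊛ B)))  ≈⟨ ≈-sym (⊛-congʳ A (⊛-assoc G B (A ⊛ Z ⊛ B))) ⟩
      A ⊛ (G ⊛ B ⊛ (A ⊛ Z ⊛ B))    ≈⟨ ≈-sym (⊛-assoc A (G ⊛ B) (A ⊛ Z ⊛ B)) ⟩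
      A ⊛ (G ⊛ B) ⊛ (A ⊛ Z ⊛ B)    ≈⟨ ⊛-congˡ (A ⊛ Z ⊛ B) (≈-sym (⊛-assoc A G B)) ⟩
      A ⊛ G ⊛ B ⊛ (A ⊛ Z ⊛ B)      ∎

inverse-of-D-equation : ∀ (U : Series) → U ≈ D ⊛ (𝟙 ⊕ B ⊛ A ⊛ U)
  → (𝟙 ⊖ sandwich D) ⊛ (𝟙 ⊕ sandwich U) ≈ 𝟙
inverse-of-D-equation U equation = inverse-of-geometric (sandwich D) (sandwich U)
  (⊛-congˡ B (⊛-congʳ A (equation ≈-∙ ⊛-one-plus D (B ⊛ A ⊛ U))) ≈-∙ sandwich-expand D U)

D-equation-of-inverse : ∀ (U : Series) → (𝟙 ⊖ sandwich D) ⊛ (𝟙 ⊕ sandwich U) ≈ 𝟙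
  → U ≈ D ⊛ (𝟙 ⊕ B ⊛ A ⊛ U)
D-equation-of-inverse U inverse =
  sandwich-injective (geometric-of-inverse (sandwich D) (sandwich U) inverse ≈-∙ ≈-sym (sandwich-expand D U))
  ≈-∙ ≈-sym (⊛-one-plus D (B ⊛ A ⊛ U))

Q : Series
Q = X ⊖ A ⊛ B ⊕ B ⊛ A

-- If U = D (1 + baU), then the equation of D gives (1 - aDb) U = 1 + QU:
-- (1 - (x - ab) - aDb) U = (1 - (x - ab) - aDb) D (1 + baU) = 1 + baU.
one-minus-aDb-⊛ : ∀ (U : Series) → U ≈ D ⊛ (𝟙 ⊕ B ⊛ A ⊛ U) → (𝟙 ⊖ sandwich D) ⊛ U ≈ 𝟙 ⊕ Q ⊛ U
one-minus-aDb-⊛ U equation w = begin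
    ((𝟙 ⊖ E) ⊛ U) w
  ≡⟨ one-minus-⊛ E U w ⟩
    U w -ᶻ (E ⊛ U) w
  ≡⟨ regroup (U w) ((Q₀ ⊛ U) w) ((E ⊛ U) w) ⟩
    (U w -ᶻ (Q₀ ⊛ U) w -ᶻ (E ⊛ U) w) +ᶻ (Q₀ ⊛ U) w
  ≡⟨ cong (_+ᶻ (Q₀ ⊛ U) w) (trans (sym (expand w)) (solved w)) ⟩
    𝟙 w +ᶻ (B ⊛ A ⊛ U) w +ᶻ (Q₀ ⊛ U) w
  ≡⟨ regroup′ (𝟙 w) ((B ⊛ A ⊛ U) w) ((Q₀ ⊛ U) w) ⟩
    𝟙 w +ᶻ ((Q₀ ⊛ U) w +ᶻ (B ⊛ A ⊛ U) w)
  ≡⟨ cong (𝟙 w +ᶻ_) (sym (⊛-distribʳ-⊕ Q₀ (B ⊛ A) U w)) ⟩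
    (𝟙 ⊕ Q ⊛ U) w ∎
  where
  open ≡-Reasoning
  E Q₀ : Series
  E = sandwich D
  Q₀ = X ⊖ A ⊛ B
  regroup : ∀ u q e → u -ᶻ e ≡ u -ᶻ q -ᶻ e +ᶻ q
  regroup = solve-∀
  regroup′ : ∀ o p q → o +ᶻ p +ᶻ q ≡ o +ᶻ (q +ᶻ p)
  regroup′ = solve-∀
  expand : (𝟙 ⊖ Q₀ ⊖ E) ⊛ U ≈ U ⊖ Q₀ ⊛ U ⊖ E ⊛ U
  expand = ⊛-distribʳ-⊖ (𝟙 ⊖ Q₀) E U ≈-∙ ⊖-cong {g = E ⊛ U} {g' = E ⊛ U} (one-minus-⊛ Q₀ U) (λ _ → refl)
  solved : (𝟙 ⊖ Q₀ ⊖ E) ⊛ U ≈ 𝟙 ⊕ B ⊛ A ⊛ U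
  solved = ⊛-congʳ (𝟙 ⊖ Q₀ ⊖ E) equation ≈-∙ ≈-sym (⊛-assoc (𝟙 ⊖ Q₀ ⊖ E) D (𝟙 ⊕ B ⊛ A ⊛ U))
         ≈-∙ ⊛-congˡ (𝟙 ⊕ B ⊛ A ⊛ U) D-equation ≈-∙ ⊛-identityˡ (𝟙 ⊕ B ⊛ A ⊛ U)

U-equation : ∀ (U : Series) → (𝟙 ⊖ sandwich D) ⊛ (𝟙 ⊕ sandwich U) ≈ 𝟙
  → (𝟙 ⊕ sandwich U) ⊛ (𝟙 ⊖ sandwich D) ≈ 𝟙 → U ≈ (𝟙 ⊕ sandwich U) ⊛ (𝟙 ⊕ Q ⊛ U)
U-equation U right left = begin
    U                                          ≈⟨ ≈-sym (⊛-identityˡ U) ⟩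
    𝟙 ⊛ U                                      ≈⟨ ⊛-congˡ U (≈-sym left) ⟩
    (𝟙 ⊕ sandwich U) ⊛ (𝟙 ⊖ sandwich D) ⊛ U    ≈⟨ ⊛-assoc (𝟙 ⊕ sandwich U) (𝟙 ⊖ sandwich D) U ⟩
    (𝟙 ⊕ sandwich U) ⊛ ((𝟙 ⊖ sandwich D) ⊛ U)  ≈⟨ ⊛-congʳ (𝟙 ⊕ sandwich U) (one-minus-aDb-⊛ U D-eq) ⟩
    (𝟙 ⊕ sandwich U) ⊛ (𝟙 ⊕ Q ⊛ U)            ∎
  where
  open ≈-Reasoning
  D-eq : U ≈ D ⊛ (𝟙 ⊕ B ⊛ A ⊛ U)
  D-eq = D-equation-of-inverse U right

-- The equation of the theorem determines U: the right-hand side is a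
-- contraction, because a and Q have no constant term.
U-equation-contractive : Contractive (λ V → (𝟙 ⊕ sandwich V) ⊛ (𝟙 ⊕ Q ⊛ V))
U-equation-contractive n V W agree =
  ⊛-agree (⊕-agree (agree-refl 𝟙) (⊛-agree (⊛-agree-shiftʳ A refl agree) (agree-refl B)))
          (⊕-agree (agree-refl 𝟙) (⊛-agree-shiftʳ Q refl agree))

-- U = D (1 + baU) has a solution, as its right-hand side is a contraction (ba
-- has no constant term).
D-equation-solution : Σ Series (λ U → U ≈ D ⊛ (𝟙 ⊕ B ⊛ A ⊛ U))
D-equation-solution = fix , fix-eq
  where
  contractive : Contractive (λ Z → D ⊛ (𝟙 ⊕ B ⊛ A ⊛ Z))
  contractive n Z Z' agree =
    ⊛-agree (agree-refl D) (⊕-agree (agree-refl 𝟙) (⊛-agree-shiftʳ (B ⊛ A) refl agree))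
  open FixedPoint (λ Z → D ⊛ (𝟙 ⊕ B ⊛ A ⊛ Z)) contractive

inverse-exists : Σ Series (λ U → ((𝟙 ⊖ sandwich D) ⊛ (𝟙 ⊕ sandwich U) ≈ 𝟙) × ((𝟙 ⊕ sandwich U) ⊛ (𝟙 ⊖ sandwich D) ≈ 𝟙))
inverse-exists with D-equation-solution
... | U₀ , equation = U₀ , right , right-inverse-two-sided (sandwich D) (𝟙 ⊕ sandwich U₀) refl right
  where right : (𝟙 ⊖ sandwich D) ⊛ (𝟙 ⊕ sandwich U₀) ≈ 𝟙
        right = inverse-of-D-equation U₀ equation

theorem4 : Σ Series (λ U → ((𝟙 ⊖ sandwich D) ⊛ (𝟙 ⊕ sandwich U) ≈ 𝟙) × ((𝟙 ⊕ sandwich U) ⊛ (𝟙 ⊖ sandwich D) ≈ 𝟙))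
    × ((U : Series) → ((𝟙 ⊖ sandwich D) ⊛ (𝟙 ⊕ sandwich U) ≈ 𝟙) → ((𝟙 ⊕ sandwich U) ⊛ (𝟙 ⊖ sandwich D) ≈ 𝟙)
      → U ≈ (𝟙 ⊕ sandwich U) ⊛ (𝟙 ⊕ (X ⊖ A ⊛ B ⊕ B ⊛ A) ⊛ U))
    × ((V W : Series) → V ≈ (𝟙 ⊕ sandwich V) ⊛ (𝟙 ⊕ (X ⊖ A ⊛ B ⊕ B ⊛ A) ⊛ V)
      → W ≈ (𝟙 ⊕ sandwich W) ⊛ (𝟙 ⊕ (X ⊖ A ⊛ B ⊕ B ⊛ A) ⊛ W) → V ≈ W)
theorem4 = inverse-exists , U-equation , λ V W → fixed-point-unique _ U-equation-contractive V W
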